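{- For any haft $T$, the Strip operation applied to $T$ returns exactly the subtrees of $T$ rooted at all primary roots of $T$.
   Context: A half-full tree (haft) is a rooted binary tree in which every non-leaf node $v$ has exactly two children, and the left child of $v$ is the root of a complete binary subtree containing at least half of $v$'s descendants. A primary root of a haft is a node that is the root of a complete subtree and whose parent (if any) is not the root of a complete subtree. Strip operation: if $T$ is a complete tree, return $T$. Otherwise, starting from the root of $T$, traverse the path towards the rightmost leaf of $T$, removing each node on it that is not a primary root, and stop when a primary root (or a leaf) is reached. Return the resulting forest. -}

module Defs where

open import Data.Nat using (ℕ; zero; suc; _+_; _≤_)
open import Data.Product using (Σ; _×_; _,_)
open import Data.List using (List; []; _∷_; _++_)
open import Data.Maybe using (Maybe; just; nothing)
open import Relation.Nullary using (Dec; yes; no; ¬_)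
open import Relation.Binary.PropositionalEquality using (_≡_; refl; sym; subst; cong)

data Tree : Set where
  leaf : Tree
  node : Tree → Tree → Tree

size : Tree → ℕ
size leaf = 1
size (node l r) = suc (size l + size r)

data Perfect : ℕ → Tree → Set where
  pleaf : Perfect zero leaf
  pnode : ∀ {n l r} → Perfect n l → Perfect n r → Perfect (suc n) (node l r)

Complete : Tree → Set
Complete t = Σ ℕ λ n → Perfect n t

-- Half-full tree: every internal node has a complete left subtree which
-- contains at least half of the node's (proper) descendants, i.e.
-- size l ≥ (size l + size r) / 2, equivalently size r ≤ size l.
data Haft : Tree → Set where
  hleaf : Haft leaf
  hnode : ∀ {l r} → Complete l → size r ≤ size l → Haft l → Haft r → Haft (node l r)

height : Tree → ℕ
height leaf = zero
height (node l r) = suc (height l)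

perfect-height : ∀ {n t} → Perfect n t → height t ≡ n
perfect-height pleaf = refl
perfect-height (pnode p q) = cong suc (perfect-height p)

perfect? : (n : ℕ) → (t : Tree) → Dec (Perfect n t)
perfect? zero leaf = yes pleaf
perfect? zero (node l r) = no λ ()
perfect? (suc n) leaf = no λ ()
perfect? (suc n) (node l r) with perfect? n l | perfect? n r
... | yes p | yes q = yes (pnode p q)
... | no ¬p | _ = no λ { (pnode p q) → ¬p p }
... | yes _ | no ¬q = no λ { (pnode p q) → ¬q q }

complete? : (t : Tree) → Dec (Complete t)
complete? t with perfect? (height t) t
... | yes p = yes (height t , p)
... | no ¬p = no λ { (n , q) → ¬p (subst (λ m → Perfect m t) (sym (perfect-height q)) q) }

-- Positions in a tree: paths from the root (root-first list of directions).
data Dir : Set where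
  goL goR : Dir

Path : Set
Path = List Dir

subtree : Tree → Path → Maybe Tree
subtree t [] = just t
subtree leaf (_ ∷ _) = nothing
subtree (node l r) (goL ∷ p) = subtree l p
subtree (node l r) (goR ∷ p) = subtree r p

PrimaryRoot : Tree → Path → Set
PrimaryRoot T p =
  Σ Tree λ S → (subtree T p ≡ just S) × Complete S ×
    (∀ q d → p ≡ q ++ (d ∷ []) → ∀ P → subtree T q ≡ just P → ¬ Complete P)

-- Strip: if T is complete return [T]; otherwise remove the nodes along the
-- path towards the rightmost leaf until a primary root (or leaf) is reached.
-- Removing a spine node detaches its left subtree as a component of the
-- forest; the forest is listed left to right.
strip : Tree → List Tree
strip leaf = leaf ∷ []
strip (node l r) with complete? (node l r)
... | yes _ = node l r ∷ []
... | no _ = l ∷ strip r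

-- A complete tree has exactly one primary root, its own root, because the
-- parent of any other node is again complete.  A node that is not complete
-- is not a primary root and does not disqualify its children, so its primary
-- roots are those of its two children.  In a haft the left child is
-- complete, so they are the left child itself and the primary roots of the
-- right child: exactly what strip detaches before recursing to the right.
module Submission where

open import Defs
open import Data.Nat using (suc)
open import Data.Empty using (⊥; ⊥-elim)
open import Data.Product using (Σ; _×_; _,_; proj₁; proj₂)
open import Data.Sum using (inj₁; inj₂; [_,_]′)
open import Data.List using (List; map; []; _∷_; _++_)
open import Data.List.Properties using (map-++; map-∘; ∷-injectiveˡ; ∷-injectiveʳ)
open import Data.Maybe using (just)
open import Data.List.Membership.Propositional using (_∈_)
open import Data.List.Membership.Propositional.Properties
  using (∈-map⁺; ∈-++⁺ˡ; ∈-++⁺ʳ; ∈-++⁻; []∉map∷; map∷-decomp∈)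
open import Data.List.Relation.Unary.Any.Properties using (singleton⁺; singleton⁻)
open import Data.List.Relation.Unary.Unique.Propositional using (Unique)
import Data.List.Relation.Unary.Unique.Propositional.Properties as Unique
open import Data.List.Relation.Unary.All using ([])
open import Data.List.Relation.Unary.AllPairs using ([]; _∷_)
open import Function.Bundles using (_⇔_; mk⇔)
open import Function.Construct.Composition using (_⇔-∘_)
open import Relation.Binary.PropositionalEquality using (_≡_; refl; sym; trans; cong; cong₂; module ≡-Reasoning)
open import Relation.Nullary using (¬_; yes; no)

strip-complete : ∀ {T} → Complete T → strip T ≡ T ∷ []
strip-complete {leaf} _ = refl
strip-complete {node l r} c with complete? (node l r)
... | yes _ = refl
... | no ¬c with () ← ¬c c

strip-incomplete : ∀ {l r} → ¬ Complete (node l r) → strip (node l r) ≡ l ∷ strip r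
strip-incomplete {l} {r} ¬c with complete? (node l r)
... | yes c with () ← ¬c c
... | no _ = refl

module _ {T U : Tree} {d : Dir} (child : ∀ p → subtree T (d ∷ p) ≡ subtree U p) where

  primaryRoot-child⁻ : ∀ {p} → PrimaryRoot T (d ∷ p) → PrimaryRoot U p
  primaryRoot-child⁻ {p} (S , at , cS , parents) =
    S , trans (sym (child p)) at , cS ,
    λ q d′ p≡ P at′ → parents (d ∷ q) d′ (cong (d ∷_) p≡) P (trans (child q) at′)

  primaryRoot-child⁺ : ¬ Complete T → ∀ {p} → PrimaryRoot U p → PrimaryRoot T (d ∷ p)
  primaryRoot-child⁺ ¬cT {p} (S , at , cS , parents) =
    S , trans (child p) at , cS , parents′
    where
    parents′ : ∀ q d′ → d ∷ p ≡ q ++ (d′ ∷ []) → ∀ P → subtree T q ≡ just P → ¬ Complete P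
    parents′ []      d′ _  P refl = ¬cT
    parents′ (_ ∷ q) d′ p≡ P at′ with refl ← ∷-injectiveˡ p≡ =
      parents q d′ (∷-injectiveʳ p≡) P (trans (sym (child q)) at′)

¬primaryRoot-complete-∷ : ∀ {T d p} → Complete T → ¬ PrimaryRoot T (d ∷ p)
¬primaryRoot-complete-∷ {T} {d} {[]} cT (_ , _ , _ , parents) = parents [] d refl T refl cT
¬primaryRoot-complete-∷ {leaf} {_} {_ ∷ _} _ (_ , () , _)
¬primaryRoot-complete-∷ {node l r} {goL} {_ ∷ _} (suc n , pnode pl _) pr =
  ¬primaryRoot-complete-∷ (n , pl) (primaryRoot-child⁻ (λ _ → refl) pr)
¬primaryRoot-complete-∷ {node l r} {goR} {_ ∷ _} (suc n , pnode _ pr′) pr =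
  ¬primaryRoot-complete-∷ (n , pr′) (primaryRoot-child⁻ (λ _ → refl) pr)

primaryRoot-complete : ∀ {T} → Complete T → ∀ p → p ≡ [] ⇔ PrimaryRoot T p
primaryRoot-complete {T} cT [] = mk⇔ (λ _ → T , refl , cT , parents) (λ _ → refl)
  where
  parents : ∀ q d → [] ≡ q ++ (d ∷ []) → ∀ P → subtree T q ≡ just P → ¬ Complete P
  parents []      _ () _ _
  parents (_ ∷ _) _ () _ _
primaryRoot-complete cT (d ∷ p) = mk⇔ (λ ()) (λ pr → ⊥-elim (¬primaryRoot-complete-∷ cT pr))

∈-[[]] : ∀ (p : Path) → p ∈ [] ∷ [] ⇔ p ≡ []
∈-[[]] p = mk⇔ singleton⁻ singleton⁺

branch : List Path → List Path → List Path
branch ps qs = map (goL ∷_) ps ++ map (goR ∷_) qs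

Branch : (Path → Set) → (Path → Set) → Path → Set
Branch A B []        = ⊥
Branch A B (goL ∷ p) = A p
Branch A B (goR ∷ p) = B p

Branch-cong : ∀ {A A′ B B′ : Path → Set} → (∀ p → A p ⇔ A′ p) → (∀ p → B p ⇔ B′ p) →
              ∀ p → Branch A B p ⇔ Branch A′ B′ p
Branch-cong A⇔ B⇔ []        = mk⇔ (λ ()) (λ ())
Branch-cong A⇔ B⇔ (goL ∷ p) = A⇔ p
Branch-cong A⇔ B⇔ (goR ∷ p) = B⇔ p

∈-branch : ∀ {ps qs} p → p ∈ branch ps qs ⇔ Branch (_∈ ps) (_∈ qs) p
∈-branch {ps} {qs} p = mk⇔ (to p) (from p)
  where
  to : ∀ p → p ∈ branch ps qs → Branch (_∈ ps) (_∈ qs) p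
  to []        m = [ []∉map∷ , []∉map∷ ]′ (∈-++⁻ (map (goL ∷_) ps) m)
  to (goL ∷ p) m with ∈-++⁻ (map (goL ∷_) ps) m
  ... | inj₁ m′ = proj₂ (map∷-decomp∈ m′)
  ... | inj₂ m′ with () ← proj₁ (map∷-decomp∈ m′)
  to (goR ∷ p) m with ∈-++⁻ (map (goL ∷_) ps) m
  ... | inj₁ m′ with () ← proj₁ (map∷-decomp∈ m′)
  ... | inj₂ m′ = proj₂ (map∷-decomp∈ m′)
  from : ∀ p → Branch (_∈ ps) (_∈ qs) p → p ∈ branch ps qs
  from (goL ∷ p) m = ∈-++⁺ˡ (∈-map⁺ (goL ∷_) m)
  from (goR ∷ p) m = ∈-++⁺ʳ _ (∈-map⁺ (goR ∷_) m)

unique-branch : ∀ {ps qs} → Unique ps → Unique qs → Unique (branch ps qs)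
unique-branch {ps} {qs} ups uqs =
  Unique.++⁺ (Unique.map⁺ ∷-injectiveʳ ups) (Unique.map⁺ ∷-injectiveʳ uqs) disjoint
  where
  disjoint : ∀ {v} → ¬ (v ∈ map (goL ∷_) ps × v ∈ map (goR ∷_) qs)
  disjoint {[]}    (mL , _)  = []∉map∷ mL
  disjoint {_ ∷ _} (mL , mR) with refl ← proj₁ (map∷-decomp∈ mL) | () ← proj₁ (map∷-decomp∈ mR)

map-subtree-branch : ∀ l r ps qs →
  map (subtree (node l r)) (branch ps qs) ≡ map (subtree l) ps ++ map (subtree r) qs
map-subtree-branch l r ps qs = begin
  map (subtree (node l r)) (map (goL ∷_) ps ++ map (goR ∷_) qs)
    ≡⟨ map-++ _ (map (goL ∷_) ps) _ ⟩
  map (subtree (node l r)) (map (goL ∷_) ps) ++ map (subtree (node l r)) (map (goR ∷_) qs)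
    ≡⟨ cong₂ _++_ (sym (map-∘ ps)) (sym (map-∘ qs)) ⟩
  map (subtree l) ps ++ map (subtree r) qs ∎
  where open ≡-Reasoning

primaryRoot-node : ∀ {l r} → ¬ Complete (node l r) →
                   ∀ p → Branch (PrimaryRoot l) (PrimaryRoot r) p ⇔ PrimaryRoot (node l r) p
primaryRoot-node ¬c []        = mk⇔ (λ ()) (λ { (_ , refl , c , _) → ¬c c })
primaryRoot-node ¬c (goL ∷ p) = mk⇔ (primaryRoot-child⁺ (λ _ → refl) ¬c) (primaryRoot-child⁻ (λ _ → refl))
primaryRoot-node ¬c (goR ∷ p) = mk⇔ (primaryRoot-child⁺ (λ _ → refl) ¬c) (primaryRoot-child⁻ (λ _ → refl))

lemma4p2 : (T : Tree) → Haft T →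
    Σ (List Path) λ ps →
      Unique ps × (∀ p → (p ∈ ps) ⇔ PrimaryRoot T p) ×
      (map just (strip T) ≡ map (subtree T) ps)
lemma4p2 T h with complete? T
... | yes cT = [] ∷ [] , [] ∷ [] ,
  (λ p → primaryRoot-complete cT p ⇔-∘ ∈-[[]] p) ,
  cong (map just) (strip-complete cT)
lemma4p2 leaf hleaf | no ¬c = ⊥-elim (¬c (0 , pleaf))
lemma4p2 (node l r) (hnode cl _ _ hr) | no ¬c with lemma4p2 r hr
... | ps , ups , ps⇔ , strip-r = branch ([] ∷ []) ps , unique-branch ([] ∷ []) ups ,
  (λ p → primaryRoot-node ¬c p ⇔-∘ (Branch-cong primaryRoots-l ps⇔ p ⇔-∘ ∈-branch p)) ,
  (begin
    map just (strip (node l r))  ≡⟨ cong (map just) (strip-incomplete ¬c) ⟩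
    just l ∷ map just (strip r)  ≡⟨ cong (just l ∷_) strip-r ⟩
    just l ∷ map (subtree r) ps  ≡⟨ sym (map-subtree-branch l r ([] ∷ []) ps) ⟩
    map (subtree (node l r)) (branch ([] ∷ []) ps) ∎)
  where
  open ≡-Reasoning
  primaryRoots-l : ∀ p → p ∈ [] ∷ [] ⇔ PrimaryRoot l p
  primaryRoots-l p = primaryRoot-complete cl p ⇔-∘ ∈-[[]] p
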